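{- Let $G=(V,E)$ be a connected graph with maximum degree $\Delta(G)$. Then \[\tau(G)\ \ge\ 2\left\lceil \sum_{e=\{u,v\}\in E}\frac{1}{(d(u)+d(v))\Delta(G)-1}\right\rceil,\] where $d(x)$ denotes the degree of $x$.
   Context: $\tau(G)$ is the dissociation number: the largest size of a vertex set $S$ such that the induced subgraph $G[S]$ has maximum degree at most $1$. -}

module Defs where

open import Data.Bool using (Bool; true; false; if_then_else_; _∧_)
open import Data.Nat as ℕ using (ℕ; zero; suc; _+_; _*_; _∸_; _⊔_; _≤_; _<?_)
open import Data.Fin using (Fin; toℕ)
open import Data.List using (List; []; _∷_; allFin; map; foldr; concatMap)
open import Data.Nat.ListAction using (sum)
open import Data.Product using (_×_; _,_)
open import Data.Integer as ℤ using (ℤ; +_)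
open import Data.Rational as ℚ using (ℚ; _/_; 0ℚ)
open import Relation.Nullary.Decidable using (⌊_⌋)
open import Relation.Binary.PropositionalEquality using (_≡_)

record Graph (n : ℕ) : Set where
  field
    adj    : Fin n → Fin n → Bool
    sym    : ∀ u v → adj u v ≡ adj v u
    irrefl : ∀ u → adj u u ≡ false
open Graph public

count : {n : ℕ} → (Fin n → Bool) → ℕ
count {n} p = sum (map (λ v → if p v then 1 else 0) (allFin n))

deg : {n : ℕ} → Graph n → Fin n → ℕ
deg G u = count (adj G u)

-- maximum degree Δ(G)  (0 for the graph with no vertices)
maxDeg : {n : ℕ} → Graph n → ℕ
maxDeg {n} G = foldr _⊔_ 0 (map (deg G) (allFin n))

-- the edge set E: each edge {u,v} listed exactly once, as the pair (u,v) with u < v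
edges : {n : ℕ} → Graph n → List (Fin n × Fin n)
edges {n} G = concatMap (λ u → concatMap (λ v →
                 if adj G u v ∧ ⌊ toℕ u <? toℕ v ⌋ then (u , v) ∷ [] else [])
               (allFin n)) (allFin n)

data Walk {n : ℕ} (G : Graph n) : Fin n → Fin n → Set where
  here : ∀ {u} → Walk G u u
  step : ∀ {u v w} → adj G u v ≡ true → Walk G v w → Walk G u w

Connected : {n : ℕ} → Graph n → Set
Connected {n} G = ∀ (u v : Fin n) → Walk G u v

-- 1/k as a rational, for k ≥ 1. (For k = 0 it returns 0; this case never
-- arises below, since for an edge (d(u)+d(v))Δ(G) - 1 ≥ 1.)
recip : ℕ → ℚ
recip zero    = 0ℚ
recip (suc k) = + 1 / suc k

edgeSum : {n : ℕ} → Graph n → ℚ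
edgeSum G = foldr (λ e acc → recip (((deg G (proj₁ e) + deg G (proj₂ e)) * maxDeg G) ∸ 1) ℚ.+ acc)
                  0ℚ (edges G)
  where open import Data.Product using (proj₁; proj₂)

IsDissociation : {n : ℕ} → Graph n → (Fin n → Bool) → Set
IsDissociation G S = ∀ u → S u ≡ true → count (λ v → S v ∧ adj G u v) ≤ 1

module Submission where

-- Give the edge e = uv the weight 1 / c(e), where c(e) = (d(u) + d(v))Δ − 1, and say that an edge f
-- conflicts with e when an endpoint of f is adjacent to an endpoint of e. At most c(e) edges conflict
-- with e (e itself included): the at most d(u) + d(v) neighbours of u and v are incident to at most Δ
-- edges each, and uv is counted twice. Greedily pick a remaining edge of minimum cost and discard all
-- edges conflicting with it; each discarded edge weighs at most 1 / c(e), so every step removes weight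
-- at most 1 and at least ⌈Σ 1 / c(e)⌉ edges are picked. They form an induced matching, and its 2|P|
-- vertices induce a graph of maximum degree 1.

open import Data.Nat using (ℕ)
open import Data.Bool using (Bool)
open import Data.Fin using (Fin)
open import Data.Product using (Σ; _×_; _,_)
open import Defs renaming (sym to adj-sym)

-- The ℕ operators opened in this module would clash with the ℤ ones of the statement at the end.
module _ where
  open import Data.Bool using (true; false; if_then_else_; _∧_; _∨_)
  open import Data.Bool.Properties using (∨-zeroʳ; ∧-conicalˡ; ∧-conicalʳ) renaming (_≟_ to _≟ᵇ_)
  open import Data.Empty using (⊥; ⊥-elim)
  open import Data.Fin using (zero; suc; toℕ; _≟_)
  open import Data.Fin.Properties using (toℕ-injective)
  import Data.Integer as ℤ
  import Data.Integer.DivMod as ℤ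
  import Data.Integer.Properties as ℤP
  open import Data.List using (List; []; _∷_; length; map; filter; concatMap; tabulate; foldr; _++_; allFin)
  open import Data.List.Extrema.Nat using (argmin; argmin-sel; f[argmin]≤f[⊤]; f[argmin]≤f[xs])
  open import Data.List.Membership.Propositional using (_∈_; lose)
  open import Data.List.Membership.Propositional.Properties using (∈-filter⁻; ∈-map⁺; ∈-allFin)
  open import Data.List.Properties using (filter-notAll; map-++)
  open import Data.List.Relation.Binary.Subset.Propositional using (_⊆_)
  import Data.List.Relation.Binary.Sublist.Propositional.Properties as Sublist
  open import Data.List.Relation.Unary.All as All using (All; []; _∷_)
  import Data.List.Relation.Unary.All.Properties as All
  open import Data.List.Relation.Unary.AllPairs using (AllPairs; []; _∷_)
  open import Data.List.Relation.Unary.Any using (here; there)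
  open import Data.Nat using (zero; suc; _+_; _*_; _∸_; _⊔_; _≤_; _<_; z≤n; s≤s; _<?_; NonZero)
  open import Data.Nat.Coprimality as Coprime using (Coprime; 1-coprimeTo)
  open import Data.Nat.Induction using (<-wellFounded)
  open import Data.Nat.ListAction using (sum)
  open import Data.Nat.ListAction.Properties using (sum-++)
  open import Data.Nat.Properties hiding (_≟_)
  open import Algebra.Properties.Semiring.Sum +-*-semiring
    using (sum-syntax; ∑-distrib-+; ∑-comm; *-distribʳ-sum; *-distribˡ-sum; sum-cong-≗; sum-replicate-zero)
  open import Data.Product using (∃-syntax; _,_; proj₁; proj₂)
  open import Data.Rational as ℚ using (ℚ; mkℚ; _/_; 0ℚ; 1ℚ)
  import Data.Rational.Properties as ℚP
  import Data.Rational.Unnormalised as ℚᵘ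
  import Data.Rational.Unnormalised.Properties as ℚᵘP
  open import Data.Sum using (_⊎_; inj₁; inj₂; [_,_]′)
  open import Function using (_∘_)
  open import Induction.WellFounded using (Acc; acc)
  open import Relation.Binary using (Rel; Decidable)
  open import Relation.Binary.PropositionalEquality
  open import Relation.Nullary using (¬_; yes; no; ¬?)
  open import Relation.Nullary.Decidable using (⌊_⌋)
  open import Relation.Nullary.Negation using (contradiction)
  import Relation.Unary as U
  import Level

  ∨-trueˡ : ∀ {x} y → x ≡ true → x ∨ y ≡ true
  ∨-trueˡ y refl = refl

  ∨-trueʳ : ∀ x {y} → y ≡ true → x ∨ y ≡ true
  ∨-trueʳ x refl = ∨-zeroʳ x

  ≡⇒≟ : ∀ {n} {x y : Fin n} → x ≡ y → ⌊ x ≟ y ⌋ ≡ true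
  ≡⇒≟ {x = x} {y} x≡y with x ≟ y
  ... | yes _   = refl
  ... | no x≢y = contradiction x≡y x≢y

  ≟⇒≡ : ∀ {n} {x y : Fin n} → ⌊ x ≟ y ⌋ ≡ true → x ≡ y
  ≟⇒≡ {x = x} {y} x≟y with x ≟ y | x≟y
  ... | yes x≡y | _ = x≡y

  𝟙 : Bool → ℕ
  𝟙 b = if b then 1 else 0

  𝟙-mono : ∀ {x y} → (x ≡ true → y ≡ true) → 𝟙 x ≤ 𝟙 y
  𝟙-mono {false} _   = z≤n
  𝟙-mono {true}  x⇒y rewrite x⇒y refl = ≤-refl

  𝟙-∨-≤ : ∀ x y → 𝟙 (x ∨ y) ≤ 𝟙 x + 𝟙 y
  𝟙-∨-≤ false y     = ≤-refl
  𝟙-∨-≤ true  false = ≤-refl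
  𝟙-∨-≤ true  true  = s≤s z≤n

  𝟙-∨-< : ∀ {x y} → x ≡ true → y ≡ true → 𝟙 (x ∨ y) < 𝟙 x + 𝟙 y
  𝟙-∨-< refl refl = ≤-refl

  𝟙-∨-disjoint : ∀ {x y} → (x ≡ true → y ≡ true → ⊥) → 𝟙 (x ∨ y) ≡ 𝟙 x + 𝟙 y
  𝟙-∨-disjoint {false}         _        = refl
  𝟙-∨-disjoint {true}  {false} _        = refl
  𝟙-∨-disjoint {true}  {true}  disjoint = ⊥-elim (disjoint refl refl)

  sum-map-mono-≤ : ∀ {a} {A : Set a} {g h : A → ℕ} → (∀ x → g x ≤ h x) → ∀ xs →
    sum (map g xs) ≤ sum (map h xs)
  sum-map-mono-≤ g≤h []       = z≤n
  sum-map-mono-≤ g≤h (x ∷ xs) = +-mono-≤ (g≤h x) (sum-map-mono-≤ g≤h xs)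

  sum-map-< : ∀ {a} {A : Set a} {g h : A → ℕ} {x xs} → (∀ x → g x ≤ h x) → x ∈ xs → g x < h x →
    sum (map g xs) < sum (map h xs)
  sum-map-< g≤h (here {xs = xs} refl) gx<hx = +-mono-<-≤ gx<hx (sum-map-mono-≤ g≤h xs)
  sum-map-< g≤h (there {x = y} x∈xs)  gx<hx = +-mono-≤-< (g≤h y) (sum-map-< g≤h x∈xs gx<hx)

  sum-map-concatMap : ∀ {a b} {A : Set a} {B : Set b} (g : B → ℕ) (f : A → List B) xs →
    sum (map g (concatMap f xs)) ≡ sum (map (λ y → sum (map g (f y))) xs)
  sum-map-concatMap g f []       = refl
  sum-map-concatMap g f (x ∷ xs) = begin
    sum (map g (f x ++ concatMap f xs))              ≡⟨ cong sum (map-++ g (f x) _) ⟩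
    sum (map g (f x) ++ map g (concatMap f xs))      ≡⟨ sum-++ (map g (f x)) _ ⟩
    sum (map g (f x)) + sum (map g (concatMap f xs)) ≡⟨ cong (sum (map g (f x)) +_) (sum-map-concatMap g f xs) ⟩
    sum (map g (f x)) + sum (map (λ y → sum (map g (f y))) xs) ∎
    where open ≡-Reasoning

  length-filter≡sum : ∀ {a} {A : Set a} (p : A → Bool) xs →
    length (filter (λ x → p x ≟ᵇ true) xs) ≡ sum (map (𝟙 ∘ p) xs)
  length-filter≡sum p []       = refl
  length-filter≡sum p (x ∷ xs) with p x
  ... | true  = cong suc (length-filter≡sum p xs)
  ... | false = length-filter≡sum p xs

  ≤-foldr-⊔ : ∀ {x xs} → x ∈ xs → x ≤ foldr _⊔_ 0 xs
  ≤-foldr-⊔ (here refl)  = m≤m⊔n _ _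
  ≤-foldr-⊔ (there x∈xs) = ≤-trans (≤-foldr-⊔ x∈xs) (m≤n⊔m _ _)

  sum-map-tabulate : ∀ {n a} {A : Set a} (g : A → ℕ) (f : Fin n → A) →
    sum (map g (tabulate f)) ≡ ∑[ i < n ] g (f i)
  sum-map-tabulate {zero}  g f = refl
  sum-map-tabulate {suc n} g f = cong (g (f zero) +_) (sum-map-tabulate g (f ∘ suc))

  ∑-mono-≤ : ∀ {n} {f g : Fin n → ℕ} → (∀ i → f i ≤ g i) → ∑[ i < n ] f i ≤ ∑[ i < n ] g i
  ∑-mono-≤ {zero}  f≤g = z≤n
  ∑-mono-≤ {suc n} f≤g = +-mono-≤ (f≤g zero) (∑-mono-≤ (f≤g ∘ suc))

  ∑∑-distrib-+ : ∀ {m n} (x y : Fin m → Fin n → ℕ) →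
    ∑[ u < m ] ∑[ v < n ] (x u v + y u v) ≡ ∑[ u < m ] ∑[ v < n ] x u v + ∑[ u < m ] ∑[ v < n ] y u v
  ∑∑-distrib-+ {m} {n} x y = trans (sum-cong-≗ (λ u → ∑-distrib-+ (x u) (y u)))
                                   (∑-distrib-+ (λ u → ∑[ v < n ] x u v) (λ u → ∑[ v < n ] y u v))

  module _ {n : ℕ} where

    count≡∑ : (p : Fin n → Bool) → count p ≡ ∑[ v < n ] 𝟙 (p v)
    count≡∑ p = sum-map-tabulate (𝟙 ∘ p) (λ v → v)

    count-mono : {p q : Fin n → Bool} → (∀ v → p v ≡ true → q v ≡ true) → count p ≤ count q
    count-mono {p} {q} p⇒q = begin
      count p              ≡⟨ count≡∑ p ⟩
      ∑[ v < n ] 𝟙 (p v)   ≤⟨ ∑-mono-≤ (λ v → 𝟙-mono (p⇒q v)) ⟩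
      ∑[ v < n ] 𝟙 (q v)   ≡⟨ count≡∑ q ⟨
      count q              ∎
      where open ≤-Reasoning

    count-∨-≤ : (p q : Fin n → Bool) → count (λ v → p v ∨ q v) ≤ count p + count q
    count-∨-≤ p q = begin
      count (λ v → p v ∨ q v)                  ≡⟨ count≡∑ (λ v → p v ∨ q v) ⟩
      ∑[ v < n ] 𝟙 (p v ∨ q v)                 ≤⟨ ∑-mono-≤ (λ v → 𝟙-∨-≤ (p v) (q v)) ⟩
      ∑[ v < n ] (𝟙 (p v) + 𝟙 (q v))           ≡⟨ ∑-distrib-+ (𝟙 ∘ p) (𝟙 ∘ q) ⟩
      ∑[ v < n ] 𝟙 (p v) + ∑[ v < n ] 𝟙 (q v)  ≡⟨ cong₂ _+_ (count≡∑ p) (count≡∑ q) ⟨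
      count p + count q                        ∎
      where open ≤-Reasoning

    count-∨-disjoint : (p q : Fin n → Bool) → (∀ v → p v ≡ true → q v ≡ true → ⊥) →
      count (λ v → p v ∨ q v) ≡ count p + count q
    count-∨-disjoint p q disjoint = begin
      count (λ v → p v ∨ q v)                  ≡⟨ count≡∑ (λ v → p v ∨ q v) ⟩
      ∑[ v < n ] 𝟙 (p v ∨ q v)                 ≡⟨ sum-cong-≗ (λ v → 𝟙-∨-disjoint (disjoint v)) ⟩
      ∑[ v < n ] (𝟙 (p v) + 𝟙 (q v))           ≡⟨ ∑-distrib-+ (𝟙 ∘ p) (𝟙 ∘ q) ⟩
      ∑[ v < n ] 𝟙 (p v) + ∑[ v < n ] 𝟙 (q v)  ≡⟨ cong₂ _+_ (count≡∑ p) (count≡∑ q) ⟨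
      count p + count q                        ∎
      where open ≡-Reasoning

  count-false : ∀ {n} → count {n} (λ _ → false) ≡ 0
  count-false {n} = trans (count≡∑ {n} (λ _ → false)) (sum-replicate-zero n)

  count-≟ : ∀ {n} (a : Fin n) → count (λ v → ⌊ v ≟ a ⌋) ≡ 1
  count-≟ {suc n} zero    = trans (count≡∑ {suc n} (λ v → ⌊ v ≟ zero ⌋)) (cong suc (sum-replicate-zero n))
  count-≟ {suc n} (suc a) = begin
    count (λ v → ⌊ v ≟ suc a ⌋)     ≡⟨ count≡∑ {suc n} (λ v → ⌊ v ≟ suc a ⌋) ⟩
    ∑[ v < n ] 𝟙 ⌊ suc v ≟ suc a ⌋  ≡⟨ sum-cong-≗ (λ v → cong 𝟙 (suc≟suc v)) ⟩
    ∑[ v < n ] 𝟙 ⌊ v ≟ a ⌋          ≡⟨ count≡∑ {n} (λ v → ⌊ v ≟ a ⌋) ⟨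
    count (λ v → ⌊ v ≟ a ⌋)         ≡⟨ count-≟ a ⟩
    1                               ∎
    where
    open ≡-Reasoning
    -- not by refl: ⌊_⌋ matches on the whole Dec record, so it does not compute through map′
    suc≟suc : ∀ v → ⌊ suc v ≟ suc a ⌋ ≡ ⌊ v ≟ a ⌋
    suc≟suc v with v ≟ a
    ... | yes _ = refl
    ... | no  _ = refl

  -- Data.Integer's +_ is opened only here: next to ℕ's _+_ it makes sections such as (m +_) ambiguous.
  module _ where
    open import Data.Integer using (+_; +≤+)

    fromℕ : ℕ → ℚ
    fromℕ k = + k / 1

    private
      fromℕ≡mkℚ : ∀ k → fromℕ k ≡ mkℚ (+ k) 0 (Coprime.sym (1-coprimeTo k))
      fromℕ≡mkℚ k = ℚP.normalize-coprime (Coprime.sym (1-coprimeTo k))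

      recip≡mkℚ : ∀ c → recip (suc c) ≡ mkℚ (+ 1) c (1-coprimeTo (suc c))
      recip≡mkℚ c = ℚP.normalize-coprime (1-coprimeTo (suc c))

      ceiling≡mkℚ : ∀ n d .(c : Coprime ℤ.∣ n ∣ (suc d)) →
        ℚ.ceiling (mkℚ n d c) ≡ ℤ.- ((ℤ.- n) ℤ./ + suc d)
      ceiling≡mkℚ (+ zero)   d c = refl
      ceiling≡mkℚ (+ suc n)  d c = refl
      ceiling≡mkℚ ℤ.-[1+ n ] d c = refl

    fromℕ-suc : ∀ k → fromℕ (suc k) ≡ 1ℚ ℚ.+ fromℕ k
    fromℕ-suc k =
      ℚP.toℚᵘ-injective (ℚᵘP.≃-trans cross (ℚᵘP.≃-sym (ℚP.toℚᵘ-homo-+ 1ℚ (fromℕ k))))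
      where
      cross : ℚ.toℚᵘ (fromℕ (suc k)) ℚᵘ.≃ ℚ.toℚᵘ 1ℚ ℚᵘ.+ ℚ.toℚᵘ (fromℕ k)
      cross rewrite fromℕ≡mkℚ k | fromℕ≡mkℚ (suc k) =
        ℚᵘ.*≡* (cong (ℤ._* + 1) (cong (ℤ._+_ (+ 1)) (sym (ℤP.*-identityʳ (+ k)))))

    fromℕ-mono-≤ : ∀ {m n} → m ≤ n → fromℕ m ℚ.≤ fromℕ n
    fromℕ-mono-≤ {m} {n} m≤n rewrite fromℕ≡mkℚ m | fromℕ≡mkℚ n =
      ℚ.*≤* (subst₂ ℤ._≤_ (sym (ℤP.*-identityʳ (+ m))) (sym (ℤP.*-identityʳ (+ n))) (+≤+ m≤n))

    recip-nonNeg : ∀ k → 0ℚ ℚ.≤ recip k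
    recip-nonNeg zero    = ℚP.≤-refl
    recip-nonNeg (suc c) rewrite recip≡mkℚ c = ℚ.*≤* (+≤+ z≤n)

    recip-antimono-≤ : ∀ {m n} → suc m ≤ n → recip n ℚ.≤ recip (suc m)
    recip-antimono-≤ {m} {suc n} (s≤s m≤n) rewrite recip≡mkℚ m | recip≡mkℚ n =
      ℚ.*≤* (subst₂ ℤ._≤_ (sym (ℤP.*-identityˡ (+ suc m))) (sym (ℤP.*-identityˡ (+ suc n)))
                          (+≤+ (s≤s m≤n)))

    fromℕ*recip≡1 : ∀ c → fromℕ (suc c) ℚ.* recip (suc c) ≡ 1ℚ
    fromℕ*recip≡1 c rewrite fromℕ≡mkℚ (suc c) | recip≡mkℚ c =
      ℚP.*-inverseʳ (mkℚ (+ suc c) 0 (Coprime.sym (1-coprimeTo (suc c))))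

    ≤-/ℕ : ∀ k a d .{{_ : NonZero d}} → k ℤ.* + d ℤ.≤ a → k ℤ.≤ a ℤ./ℕ d
    ≤-/ℕ k a d kd≤a = subst (k ℤ.≤_) (ℤP.pred-suc (a ℤ./ℕ d)) (ℤP.i<j⇒i≤pred[j]
      (ℤP.*-cancelʳ-<-nonNeg {j = ℤ.suc (a ℤ./ℕ d)} (+ d) (ℤP.≤-<-trans kd≤a (ℤ.n<s[n/ℕd]*d a d))))

    ceiling-≤ : ∀ q m → q ℚ.≤ fromℕ m → ℚ.ceiling q ℤ.≤ + m
    ceiling-≤ q m q≤m = ceiling-≤-mkℚ q (subst (q ℚ.≤_) (fromℕ≡mkℚ m) q≤m)
      where
      open ℤP.≤-Reasoning
      ceiling-≤-mkℚ : ∀ q → q ℚ.≤ mkℚ (+ m) 0 (Coprime.sym (1-coprimeTo m)) → ℚ.ceiling q ℤ.≤ + m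
      ceiling-≤-mkℚ (mkℚ n d c) (ℚ.*≤* n≤m*d) = begin
        ℚ.ceiling (mkℚ n d c)      ≡⟨ ceiling≡mkℚ n d c ⟩
        ℤ.- ((ℤ.- n) ℤ./ + suc d)  ≡⟨ cong ℤ.-_ (ℤ.div-pos-is-/ℕ (ℤ.- n) (suc d)) ⟩
        ℤ.- ((ℤ.- n) ℤ./ℕ suc d)   ≤⟨ ℤP.neg-mono-≤ (≤-/ℕ (ℤ.- (+ m)) (ℤ.- n) (suc d) -m*d≤-n) ⟩
        ℤ.- (ℤ.- (+ m))            ≡⟨ ℤP.neg-involutive (+ m) ⟩
        + m                        ∎
        where
        -m*d≤-n : ℤ.- (+ m) ℤ.* + suc d ℤ.≤ ℤ.- n
        -m*d≤-n = subst₂ ℤ._≤_ (ℤP.neg-distribˡ-* (+ m) (+ suc d)) (cong ℤ.-_ (ℤP.*-identityʳ n))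
                    (ℤP.neg-mono-≤ n≤m*d)

  module _ {a} {A : Set a} (cost : A → ℕ) where

    weight : List A → ℚ
    weight = foldr (λ e acc → recip (cost e) ℚ.+ acc) 0ℚ

    weight-partition : ∀ {p} {P : U.Pred A p} (P? : U.Decidable P) L →
      weight L ≡ weight (filter P? L) ℚ.+ weight (filter (¬? ∘ P?) L)
    weight-partition P? []      = sym (ℚP.+-identityˡ 0ℚ)
    weight-partition P? (x ∷ L) with P? x
    ... | yes _ = trans (cong (w ℚ.+_) (weight-partition P? L)) (sym (ℚP.+-assoc w _ _))
      where
      w : ℚ
      w = recip (cost x)
    ... | no _  = begin
      w ℚ.+ weight L   ≡⟨ cong (w ℚ.+_) (weight-partition P? L) ⟩
      w ℚ.+ (Y ℚ.+ N)  ≡⟨ ℚP.+-assoc w Y N ⟨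
      (w ℚ.+ Y) ℚ.+ N  ≡⟨ cong (ℚ._+ N) (ℚP.+-comm w Y) ⟩
      (Y ℚ.+ w) ℚ.+ N  ≡⟨ ℚP.+-assoc Y w N ⟩
      Y ℚ.+ (w ℚ.+ N)  ∎
      where
      open ≡-Reasoning
      w Y N : ℚ
      w = recip (cost x)
      Y = weight (filter P? L)
      N = weight (filter (¬? ∘ P?) L)

    weight≤length* : ∀ {r} L → All (λ f → recip (cost f) ℚ.≤ r) L → weight L ℚ.≤ fromℕ (length L) ℚ.* r
    weight≤length* {r} []      []             = ℚP.≤-reflexive (sym (ℚP.*-zeroˡ r))
    weight≤length* {r} (f ∷ L) (wf≤r ∷ wL≤r) = begin
      recip (cost f) ℚ.+ weight L            ≤⟨ ℚP.+-mono-≤ wf≤r (weight≤length* L wL≤r) ⟩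
      r ℚ.+ fromℕ (length L) ℚ.* r           ≡⟨ cong (ℚ._+ fromℕ (length L) ℚ.* r) (ℚP.*-identityˡ r) ⟨
      1ℚ ℚ.* r ℚ.+ fromℕ (length L) ℚ.* r    ≡⟨ ℚP.*-distribʳ-+ r 1ℚ (fromℕ (length L)) ⟨
      (1ℚ ℚ.+ fromℕ (length L)) ℚ.* r        ≡⟨ cong (ℚ._* r) (fromℕ-suc (length L)) ⟨
      fromℕ (suc (length L)) ℚ.* r           ∎
      where open ℚP.≤-Reasoning

    weight≤1 : ∀ c L → All (λ f → c ≤ cost f) L → length L ≤ c → weight L ℚ.≤ 1ℚ
    weight≤1 zero    [] _    _     = ℚ.*≤* (ℤ.+≤+ z≤n)
    weight≤1 (suc c) L  c≤cL |L|≤c = begin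
      weight L                            ≤⟨ weight≤length* L (All.map recip-antimono-≤ c≤cL) ⟩
      fromℕ (length L) ℚ.* recip (suc c)  ≤⟨ ℚP.*-monoʳ-≤-nonNeg (recip (suc c)) {{r≥0}} (fromℕ-mono-≤ |L|≤c) ⟩
      fromℕ (suc c) ℚ.* recip (suc c)     ≡⟨ fromℕ*recip≡1 c ⟩
      1ℚ                                  ∎
      where
      open ℚP.≤-Reasoning
      r≥0 : ℚ.NonNegative (recip (suc c))
      r≥0 = ℚ.nonNegative (recip-nonNeg (suc c))

  module _ {a ℓ} {A : Set a} {_#_ : Rel A ℓ} (_#?_ : Decidable _#_) (cost : A → ℕ) where

    SelfConflicting : List A → Set (a Level.⊔ ℓ)
    SelfConflicting L = ∀ {e} → e ∈ L → e # e

    ConflictBounded : List A → Set a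
    ConflictBounded L = ∀ {e} → e ∈ L → length (filter (e #?_) L) ≤ cost e

    Packing : List A → Set (a Level.⊔ ℓ)
    Packing L = ∃[ P ] P ⊆ L × AllPairs (λ e f → ¬ e # f) P × weight cost L ℚ.≤ fromℕ (length P)

    ConflictBounded-filter : ∀ {p} {P : U.Pred A p} (P? : U.Decidable P) {L} →
      ConflictBounded L → ConflictBounded (filter P? L)
    ConflictBounded-filter P? {L} bounded {f} f∈PL = ≤-trans
      (Sublist.length-mono-≤ (Sublist.filter⁺ (f #?_) (f #?_) (λ { refl p → p }) (Sublist.filter-⊆ P? L)))
      (bounded (proj₁ (∈-filter⁻ P? f∈PL)))

    conflictFree-packing : ∀ L → SelfConflicting L → ConflictBounded L → Packing L
    conflictFree-packing L = go L (<-wellFounded (length L))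
      where
      go : ∀ L → Acc _<_ (length L) → SelfConflicting L → ConflictBounded L → Packing L
      go []          _         _    _       = [] , (λ ()) , [] , ℚP.≤-refl
      go L@(x ∷ xs) (acc rec) self bounded = e ∷ P , e∷P⊆L , e#̸P ∷ P-free , L≤1+|P|
        where
        e : A
        e = argmin cost x xs
        e∈L : e ∈ L
        e∈L = [ here , there ]′ (argmin-sel cost x xs)
        e-minimal : All (λ f → cost e ≤ cost f) L
        e-minimal = f[argmin]≤f[⊤] {f = cost} x xs ∷ f[argmin]≤f[xs] {f = cost} x xs
        near far : List A
        near = filter (e #?_) L
        far  = filter (¬? ∘ (e #?_)) L
        far<L : length far < length L
        far<L = filter-notAll (¬? ∘ (e #?_)) L (lose e∈L (λ e#̸e → e#̸e (self e∈L)))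
        rest : Packing far
        rest = go far (rec far<L) (self ∘ proj₁ ∘ ∈-filter⁻ (¬? ∘ (e #?_)))
                 (ConflictBounded-filter (¬? ∘ (e #?_)) bounded)
        P : List A
        P = proj₁ rest
        P⊆far : P ⊆ far
        P⊆far = proj₁ (proj₂ rest)
        P-free : AllPairs (λ e f → ¬ e # f) P
        P-free = proj₁ (proj₂ (proj₂ rest))
        far≤|P| : weight cost far ℚ.≤ fromℕ (length P)
        far≤|P| = proj₂ (proj₂ (proj₂ rest))
        e∷P⊆L : e ∷ P ⊆ L
        e∷P⊆L (here refl)  = e∈L
        e∷P⊆L (there f∈P) = proj₁ (∈-filter⁻ (¬? ∘ (e #?_)) (P⊆far f∈P))
        e#̸P : All (λ f → ¬ e # f) P
        e#̸P = All.tabulate (proj₂ ∘ ∈-filter⁻ (¬? ∘ (e #?_)) ∘ P⊆far)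
        near≤1 : weight cost near ℚ.≤ 1ℚ
        near≤1 = weight≤1 cost (cost e) near
          (All.tabulate (All.lookup e-minimal ∘ proj₁ ∘ ∈-filter⁻ (e #?_))) (bounded e∈L)
        L≤1+|P| : weight cost L ℚ.≤ fromℕ (suc (length P))
        L≤1+|P| = begin
          weight cost L                         ≡⟨ weight-partition cost (e #?_) L ⟩
          weight cost near ℚ.+ weight cost far  ≤⟨ ℚP.+-mono-≤ near≤1 far≤|P| ⟩
          1ℚ ℚ.+ fromℕ (length P)               ≡⟨ fromℕ-suc (length P) ⟨
          fromℕ (suc (length P))                ∎
          where open ℚP.≤-Reasoning

  module _ {n : ℕ} (G : Graph n) where

    Edge : Set
    Edge = Fin n × Fin n

    IsEdge : Edge → Set
    IsEdge (u , v) = adj G u v ≡ true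

    cost : Edge → ℕ
    cost (u , v) = (deg G u + deg G v) * maxDeg G ∸ 1

    deg≤maxDeg : ∀ u → deg G u ≤ maxDeg G
    deg≤maxDeg u = ≤-foldr-⊔ (∈-map⁺ (deg G) (∈-allFin u))

    private
      lt : Fin n → Fin n → Bool
      lt u v = ⌊ toℕ u <? toℕ v ⌋

      edges-at : Fin n → Fin n → List Edge
      edges-at u v = if adj G u v ∧ lt u v then (u , v) ∷ [] else []

      orientations : ∀ {u v} → u ≢ v → 𝟙 (lt u v) + 𝟙 (lt v u) ≡ 1
      orientations {u} {v} u≢v with toℕ u <? toℕ v | toℕ v <? toℕ u
      ... | yes u<v | yes v<u = ⊥-elim (<-asym u<v v<u)
      ... | yes _   | no _    = refl
      ... | no _    | yes _   = refl
      ... | no u≮v  | no v≮u  = ⊥-elim (u≢v (toℕ-injective (≤-antisym (≮⇒≥ v≮u) (≮⇒≥ u≮v))))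

      listed-once : ∀ u v → 𝟙 (adj G u v ∧ lt u v) + 𝟙 (adj G v u ∧ lt v u) ≡ 𝟙 (adj G u v)
      listed-once u v rewrite adj-sym G v u with adj G u v in uv
      ... | false = refl
      ... | true  = orientations {u} {v} λ { refl → contradiction (trans (sym uv) (irrefl G u)) λ () }

      sum-map-edges-at : ∀ (g : Edge → ℕ) u v →
        sum (map g (edges-at u v)) ≡ 𝟙 (adj G u v ∧ lt u v) * g (u , v)
      sum-map-edges-at g u v with adj G u v ∧ lt u v
      ... | true  = refl
      ... | false = refl

      sum-map-edges : ∀ (g : Edge → ℕ) →
        sum (map g (edges G)) ≡ ∑[ u < n ] ∑[ v < n ] (𝟙 (adj G u v ∧ lt u v) * g (u , v))
      sum-map-edges g = begin
        sum (map g (concatMap (λ u → concatMap (edges-at u) (allFin n)) (allFin n)))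
          ≡⟨ sum-map-concatMap g _ (allFin n) ⟩
        sum (map (λ u → sum (map g (concatMap (edges-at u) (allFin n)))) (allFin n))
          ≡⟨ sum-map-tabulate (λ u → sum (map g (concatMap (edges-at u) (allFin n)))) (λ u → u) ⟩
        ∑[ u < n ] sum (map g (concatMap (edges-at u) (allFin n)))
          ≡⟨ sum-cong-≗ (λ u → trans (sum-map-concatMap g (edges-at u) (allFin n))
                                     (sum-map-tabulate (λ v → sum (map g (edges-at u v))) (λ v → v))) ⟩
        ∑[ u < n ] ∑[ v < n ] sum (map g (edges-at u v))
          ≡⟨ sum-cong-≗ (λ u → sum-cong-≗ (sum-map-edges-at g u)) ⟩
        ∑[ u < n ] ∑[ v < n ] (𝟙 (adj G u v ∧ lt u v) * g (u , v)) ∎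
        where open ≡-Reasoning

    ∈-edges⇒IsEdge : ∀ {e} → e ∈ edges G → IsEdge e
    ∈-edges⇒IsEdge = All.lookup
      (All.concat⁺ (All.map⁺ (All.tabulate⁺ λ u → All.concat⁺ (All.map⁺ (All.tabulate⁺ (listed u))))))
      where
      listed : ∀ u v → All IsEdge (edges-at u v)
      listed u v with adj G u v ∧ lt u v in uv
      ... | true  = ∧-conicalˡ _ _ uv ∷ []
      ... | false = []

    handshake : ∀ (f : Fin n → ℕ) →
      sum (map (λ e → f (proj₁ e) + f (proj₂ e)) (edges G)) ≡ ∑[ u < n ] (deg G u * f u)
    handshake f = begin
      sum (map (λ e → f (proj₁ e) + f (proj₂ e)) (edges G))
        ≡⟨ sum-map-edges (λ e → f (proj₁ e) + f (proj₂ e)) ⟩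
      ∑[ u < n ] ∑[ v < n ] (o u v * (f u + f v))
        ≡⟨ sum-cong-≗ (λ u → sum-cong-≗ (λ v → *-distribˡ-+ (o u v) (f u) (f v))) ⟩
      ∑[ u < n ] ∑[ v < n ] (o u v * f u + o u v * f v)
        ≡⟨ ∑∑-distrib-+ (λ u v → o u v * f u) (λ u v → o u v * f v) ⟩
      ∑[ u < n ] ∑[ v < n ] (o u v * f u) + ∑[ u < n ] ∑[ v < n ] (o u v * f v)
        ≡⟨ cong (∑[ u < n ] ∑[ v < n ] (o u v * f u) +_) (∑-comm (λ u v → o u v * f v)) ⟩
      ∑[ u < n ] ∑[ v < n ] (o u v * f u) + ∑[ u < n ] ∑[ v < n ] (o v u * f u)
        ≡⟨ ∑∑-distrib-+ (λ u v → o u v * f u) (λ u v → o v u * f u) ⟨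
      ∑[ u < n ] ∑[ v < n ] (o u v * f u + o v u * f u)
        ≡⟨ sum-cong-≗ (λ u → sum-cong-≗ (λ v →
             trans (sym (*-distribʳ-+ (f u) (o u v) (o v u))) (cong (_* f u) (listed-once u v)))) ⟩
      ∑[ u < n ] ∑[ v < n ] (𝟙 (adj G u v) * f u)
        ≡⟨ sum-cong-≗ (λ u → *-distribʳ-sum (f u) (λ v → 𝟙 (adj G u v))) ⟨
      ∑[ u < n ] ((∑[ v < n ] 𝟙 (adj G u v)) * f u)
        ≡⟨ sum-cong-≗ (λ u → cong (_* f u) (count≡∑ (adj G u))) ⟨
      ∑[ u < n ] (deg G u * f u) ∎
      where
      open ≡-Reasoning
      o : Fin n → Fin n → ℕ
      o u v = 𝟙 (adj G u v ∧ lt u v)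

    touches : Edge → Fin n → Bool
    touches (u , v) x = adj G u x ∨ adj G v x

    conflict : Edge → Edge → Bool
    conflict e (x , y) = touches e x ∨ touches e y

    Conflict : Edge → Edge → Set
    Conflict e f = conflict e f ≡ true

    conflict? : Decidable Conflict
    conflict? e f = conflict e f ≟ᵇ true

    touches-proj₁ : ∀ {e} → IsEdge e → touches e (proj₁ e) ≡ true
    touches-proj₁ {u , v} uv = ∨-trueʳ (adj G u u) (trans (adj-sym G v u) uv)

    touches-proj₂ : ∀ {e} → IsEdge e → touches e (proj₂ e) ≡ true
    touches-proj₂ {u , v} uv = ∨-trueˡ (adj G v v) uv

    conflicts≤cost : ∀ {e} → e ∈ edges G → length (filter (conflict? e) (edges G)) ≤ cost e
    conflicts≤cost {e@(u , v)} e∈E = <⇒≤∸1 (begin-strict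
      length (filter (conflict? e) (edges G))   ≡⟨ length-filter≡sum (conflict e) (edges G) ⟩
      sum (map (𝟙 ∘ conflict e) (edges G))
        <⟨ sum-map-< (λ f → 𝟙-∨-≤ (touches e (proj₁ f)) (touches e (proj₂ f))) e∈E
                     (𝟙-∨-< (touches-proj₁ uv) (touches-proj₂ uv)) ⟩
      sum (map (λ f → 𝟙 (touches e (proj₁ f)) + 𝟙 (touches e (proj₂ f))) (edges G))
        ≡⟨ handshake (𝟙 ∘ touches e) ⟩
      ∑[ x < n ] (deg G x * 𝟙 (touches e x))    ≤⟨ ∑-mono-≤ (λ x → *-monoˡ-≤ (𝟙 (touches e x)) (deg≤maxDeg x)) ⟩
      ∑[ x < n ] (maxDeg G * 𝟙 (touches e x))   ≡⟨ *-distribˡ-sum (maxDeg G) (𝟙 ∘ touches e) ⟨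
      maxDeg G * ∑[ x < n ] 𝟙 (touches e x)     ≡⟨ cong (maxDeg G *_) (count≡∑ (touches e)) ⟨
      maxDeg G * count (touches e)              ≤⟨ *-monoʳ-≤ (maxDeg G) (count-∨-≤ (adj G u) (adj G v)) ⟩
      maxDeg G * (deg G u + deg G v)            ≡⟨ *-comm (maxDeg G) (deg G u + deg G v) ⟩
      (deg G u + deg G v) * maxDeg G            ∎)
      where
      open ≤-Reasoning
      uv : IsEdge e
      uv = ∈-edges⇒IsEdge e∈E
      <⇒≤∸1 : ∀ {m k} → m < k → m ≤ k ∸ 1
      <⇒≤∸1 {m} {k} m<k = subst (m ≤_) (pred[m∸n]≡m∸[1+n] k 0) (<⇒≤pred m<k)

    covers : Edge → Fin n → Bool
    covers (u , v) x = ⌊ x ≟ u ⌋ ∨ ⌊ x ≟ v ⌋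

    covers-proj₁ : ∀ e → covers e (proj₁ e) ≡ true
    covers-proj₁ (u , v) = ∨-trueˡ ⌊ u ≟ v ⌋ (≡⇒≟ refl)

    covers⇒endpoint : ∀ e x → covers e x ≡ true → x ≡ proj₁ e ⊎ x ≡ proj₂ e
    covers⇒endpoint (u , v) x cx with x ≟ u | x ≟ v | cx
    ... | yes x≡u | _       | _ = inj₁ x≡u
    ... | no _    | yes x≡v | _ = inj₂ x≡v
    ... | no _    | no _    | ()

    touches-covered : ∀ {e x} → IsEdge e → covers e x ≡ true → touches e x ≡ true
    touches-covered {e} {x} uv cx with covers⇒endpoint e x cx
    ... | inj₁ refl = touches-proj₁ uv
    ... | inj₂ refl = touches-proj₂ uv

    touches-neighbour : ∀ {e x y} → covers e x ≡ true → adj G x y ≡ true → touches e y ≡ true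
    touches-neighbour {u , v} {x} cx xy with covers⇒endpoint (u , v) x cx
    ... | inj₁ refl = ∨-trueˡ (adj G v _) xy
    ... | inj₂ refl = ∨-trueʳ (adj G u _) xy

    conflict-touching : ∀ {e f y} → covers f y ≡ true → touches e y ≡ true → Conflict e f
    conflict-touching {e} {x , x′} {y} cy ty with covers⇒endpoint (x , x′) y cy
    ... | inj₁ refl = ∨-trueˡ (touches e x′) ty
    ... | inj₂ refl = ∨-trueʳ (touches e x) ty

    conflict-refl : ∀ {e} → IsEdge e → Conflict e e
    conflict-refl {e} uv = conflict-touching (covers-proj₁ e) (touches-proj₁ uv)

    conflict-adjacent : ∀ {e f x y} → covers e x ≡ true → covers f y ≡ true → adj G x y ≡ true → Conflict e f
    conflict-adjacent cx cy xy = conflict-touching cy (touches-neighbour cx xy)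

    ConflictFree : List Edge → Set
    ConflictFree = AllPairs (λ e f → ¬ Conflict e f)

    vertices : List Edge → Fin n → Bool
    vertices []      x = false
    vertices (e ∷ P) x = covers e x ∨ vertices P x

    vertices⇒covered : ∀ P {x} → vertices P x ≡ true → ∃[ e ] e ∈ P × covers e x ≡ true
    vertices⇒covered (e ∷ P) {x} Px with covers e x in cx
    ... | true  = e , here refl , cx
    ... | false with vertices⇒covered P Px
    ...   | f , f∈P , cf = f , there f∈P , cf

    adjacent⇒same-edge : ∀ {P e f x y} → ConflictFree P → e ∈ P → f ∈ P →
      covers e x ≡ true → covers f y ≡ true → adj G x y ≡ true → e ≡ f
    adjacent⇒same-edge (_ ∷ _)     (here refl)  (here refl)  _  _  _  = refl
    adjacent⇒same-edge (e#̸P ∷ _)  (here refl)  (there f∈P) cx cy xy =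
      ⊥-elim (All.lookup e#̸P f∈P (conflict-adjacent cx cy xy))
    adjacent⇒same-edge (f#̸P ∷ _)  (there e∈P) (here refl)  cx cy xy =
      ⊥-elim (All.lookup f#̸P e∈P (conflict-adjacent cy cx (trans (adj-sym G _ _) xy)))
    adjacent⇒same-edge (_ ∷ free)  (there e∈P) (there f∈P) cx cy xy =
      adjacent⇒same-edge free e∈P f∈P cx cy xy

    partner : Edge → Fin n → Fin n
    partner (u , v) x = if ⌊ x ≟ u ⌋ then v else u

    ≡partner : ∀ {e x y} → covers e x ≡ true → covers e y ≡ true → y ≢ x → y ≡ partner e x
    ≡partner {u , v} {x} {y} cx cy y≢x
      with covers⇒endpoint (u , v) x cx | covers⇒endpoint (u , v) y cy | x ≟ u
    ... | _         | inj₁ refl | yes refl = ⊥-elim (y≢x refl)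
    ... | _         | inj₂ refl | yes refl = refl
    ... | _         | inj₁ refl | no _     = refl
    ... | inj₁ refl | inj₂ refl | no x≢u   = ⊥-elim (x≢u refl)
    ... | inj₂ refl | inj₂ refl | no _     = ⊥-elim (y≢x refl)

    conflictFree-dissociation : ∀ {P} → ConflictFree P → IsDissociation G (vertices P)
    conflictFree-dissociation {P} free x Px with vertices⇒covered P Px
    ... | e , e∈P , cx = begin
      count (λ y → vertices P y ∧ adj G x y)  ≤⟨ count-mono is-partner ⟩
      count (λ y → ⌊ y ≟ partner e x ⌋)      ≡⟨ count-≟ (partner e x) ⟩
      1                                       ∎
      where
      open ≤-Reasoning
      is-partner : ∀ y → vertices P y ∧ adj G x y ≡ true → ⌊ y ≟ partner e x ⌋ ≡ true
      is-partner y h with vertices⇒covered P (∧-conicalˡ _ _ h)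
      ... | f , f∈P , cy = ≡⇒≟ (≡partner cx (subst (λ g → covers g y ≡ true) (sym e≡f) cy) y≢x)
        where
        xy : adj G x y ≡ true
        xy = ∧-conicalʳ _ _ h
        e≡f : e ≡ f
        e≡f = adjacent⇒same-edge free e∈P f∈P cx cy xy
        y≢x : y ≢ x
        y≢x refl = contradiction (trans (sym xy) (irrefl G x)) λ ()

    count-covers : ∀ {e} → IsEdge e → count (covers e) ≡ 2
    count-covers {u , v} uv = trans (count-∨-disjoint _ _ disjoint) (cong₂ _+_ (count-≟ u) (count-≟ v))
      where
      disjoint : ∀ x → ⌊ x ≟ u ⌋ ≡ true → ⌊ x ≟ v ⌋ ≡ true → ⊥
      disjoint x xu xv with ≟⇒≡ xu | ≟⇒≡ xv
      ... | refl | refl = contradiction (trans (sym uv) (irrefl G x)) λ ()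

    count-vertices : ∀ {P} → All IsEdge P → ConflictFree P → count (vertices P) ≡ 2 * length P
    count-vertices {[]}    []        []            = count-false {n}
    count-vertices {e ∷ P} (uv ∷ es) (e#̸P ∷ free) = begin
      count (λ x → covers e x ∨ vertices P x)  ≡⟨ count-∨-disjoint (covers e) (vertices P) disjoint ⟩
      count (covers e) + count (vertices P)    ≡⟨ cong₂ _+_ (count-covers uv) (count-vertices es free) ⟩
      2 + 2 * length P                         ≡⟨ *-suc 2 (length P) ⟨
      2 * suc (length P)                       ∎
      where
      open ≡-Reasoning
      disjoint : ∀ x → covers e x ≡ true → vertices P x ≡ true → ⊥
      disjoint x cx Px with vertices⇒covered P Px
      ... | f , f∈P , cf = All.lookup e#̸P f∈P (conflict-touching {y = x} cf (touches-covered uv cx))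

    -- edgeSum G and weight cost (edges G) coincide definitionally.
    large-induced-matching : ∃[ P ] All IsEdge P × ConflictFree P × edgeSum G ℚ.≤ fromℕ (length P)
    large-induced-matching
      with conflictFree-packing conflict? cost (edges G) (conflict-refl ∘ ∈-edges⇒IsEdge) conflicts≤cost
    ... | P , P⊆E , P-free , edgeSum≤|P| = P , All.tabulate (∈-edges⇒IsEdge ∘ P⊆E) , P-free , edgeSum≤|P|

open import Data.Integer using (+_; _≤_; _*_)
open import Data.Rational using (ceiling)
import Data.Integer.Properties as ℤP
open import Data.List using (length)
open import Relation.Binary.PropositionalEquality using (cong; trans)

proposition9p3 : (n : ℕ) (G : Graph n) → Connected G →
    Σ (Fin n → Bool) (λ S → IsDissociation G S × (+ 2 * ⌈ edgeSum G ⌉ ≤ + count S))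
proposition9p3 n G _ with large-induced-matching G
... | P , P-edges , P-free , edgeSum≤|P| = vertices G P , conflictFree-dissociation G P-free , size
  where
  open ℤP.≤-Reasoning
  size : + 2 * ⌈ edgeSum G ⌉ ≤ + count (vertices G P)
  size = begin
    + 2 * ⌈ edgeSum G ⌉       ≤⟨ ℤP.*-monoˡ-≤-nonNeg (+ 2) (ceiling-≤ (edgeSum G) (length P) edgeSum≤|P|) ⟩
    + 2 * + length P          ≡⟨ trans (cong +_ (count-vertices G P-edges P-free)) (ℤP.pos-* 2 (length P)) ⟨
    + count (vertices G P)    ∎
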